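{- Let $T$ be a complete first-order theory, $M\models T$, $A\subseteq M$, with $M$ atomic and strongly $\omega$-homogeneous over $A$, and let $\mathcal G=Aut(M/A)$. Let $\phi(\bar x,\bar y)$ be a formula with parameters from $A$ and $\bar b$ a finite tuple from $M$ such that $\{\sigma\in\mathcal G: M\models\phi(\sigma(\bar b),\bar b)\}$ is a subgroup of $\mathcal G$. Let $\psi(\bar x)$ be a formula over $A$ isolating $tp(\bar b/A)$. Then $\phi(\bar x,\bar y)$ defines an equivalence relation on the set of realizations of $\psi$ in $M$ (and also in the monster model).
   Context: $M$ is atomic over $A$ if the type over $A$ of every finite tuple from $M$ is isolated; $M$ is strongly $\omega$-homogeneous over $A$ if whenever finite tuples $a,b$ from $M$ have the same type over $A$, there is $\sigma\in Aut(M/A)$ with $\sigma(a)=b$. -}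

module Defs where

open import Data.Nat using (ℕ; zero; suc; _+_)
open import Data.Fin using (Fin)
open import Data.Vec using (Vec; []; _∷_; map)
open import Data.Vec.Properties using (map-∘; map-cong; map-id)
import Data.Vec.Functional as VF
open import Data.Empty using (⊥)
open import Data.Product using (Σ; _×_; _,_; proj₁)
open import Data.Sum using (_⊎_)
open import Relation.Nullary using (¬_)
open import Relation.Binary.PropositionalEquality
open import Function.Bundles using (_⇔_; mk⇔; Equivalence)

record Signature : Set₁ where
  field
    Func   : Set
    farity : Func → ℕ
    Rel    : Set
    rarity : Rel → ℕ
open Signature public

record Structure (L : Signature) : Set₁ where
  field
    Carrier : Set
    funI    : (f : Func L) → Vec Carrier (farity L f) → Carrier
    relI    : (r : Rel L) → Vec Carrier (rarity L r) → Set
open Structure public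

data Term (L : Signature) (P : Set) (k : ℕ) : Set where
  var : Fin k → Term L P k
  par : P → Term L P k
  app : (f : Func L) → Vec (Term L P k) (farity L f) → Term L P k

data Formula (L : Signature) (P : Set) : ℕ → Set where
  ⊥'   : ∀ {k} → Formula L P k
  _≐_  : ∀ {k} → Term L P k → Term L P k → Formula L P k
  rel  : ∀ {k} (r : Rel L) → Vec (Term L P k) (rarity L r) → Formula L P k
  ¬'_  : ∀ {k} → Formula L P k → Formula L P k
  _∧'_ : ∀ {k} → Formula L P k → Formula L P k → Formula L P k
  _∨'_ : ∀ {k} → Formula L P k → Formula L P k → Formula L P k
  _⇒'_ : ∀ {k} → Formula L P k → Formula L P k → Formula L P k
  ∀'_  : ∀ {k} → Formula L P (suc k) → Formula L P k
  ∃'_  : ∀ {k} → Formula L P (suc k) → Formula L P k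

Sentence : Signature → Set
Sentence L = Formula L ⊥ 0

-- Classical (Tarskian) satisfaction, rendered via the Gödel–Gentzen
-- negative translation so that it is ¬¬-stable.

module _ {L : Signature} (M : Structure L) where
  private C = Carrier M

  mutual
    eval : ∀ {P k} → (P → C) → (Fin k → C) → Term L P k → C
    eval π s (var i)    = s i
    eval π s (par p)    = π p
    eval π s (app f ts) = funI M f (evals π s ts)

    evals : ∀ {P k n} → (P → C) → (Fin k → C) → Vec (Term L P k) n → Vec C n
    evals π s []       = []
    evals π s (t ∷ ts) = eval π s t ∷ evals π s ts

  Sat : ∀ {P k} → (P → C) → (Fin k → C) → Formula L P k → Set
  Sat π s ⊥'         = ⊥
  Sat π s (t ≐ u)    = ¬ ¬ (eval π s t ≡ eval π s u)
  Sat π s (rel r ts) = ¬ ¬ relI M r (evals π s ts)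
  Sat π s (¬' φ)     = ¬ Sat π s φ
  Sat π s (φ ∧' ψ)   = Sat π s φ × Sat π s ψ
  Sat π s (φ ∨' ψ)   = ¬ (¬ Sat π s φ × ¬ Sat π s ψ)
  Sat π s (φ ⇒' ψ)   = Sat π s φ → Sat π s ψ
  Sat π s (∀' φ)     = ∀ (c : C) → Sat π (c VF.∷ s) φ
  Sat π s (∃' φ)     = ¬ (∀ (c : C) → ¬ Sat π (c VF.∷ s) φ)

noParams : {C : Set} → ⊥ → C
noParams ()

noVars : {C : Set} → Fin 0 → C
noVars ()

_⊨_ : ∀ {L} → Structure L → Sentence L → Set
M ⊨ σ = Sat M noParams noVars σ

Theory : Signature → Set₁
Theory L = Sentence L → Set

IsModel : ∀ {L} → Theory L → Structure L → Set
IsModel T M = ∀ σ → T σ → M ⊨ σ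

_⊫_ : ∀ {L} → Theory L → Sentence L → Set₁
T ⊫ σ = ∀ (N : Structure _) → IsModel T N → N ⊨ σ

Complete : ∀ {L} → Theory L → Set₁
Complete {L} T = (Σ (Structure L) (IsModel T)) × (∀ σ → (T ⊫ σ) ⊎ (T ⊫ (¬' σ)))

module _ {L : Signature} (M : Structure L) (A : Carrier M → Set) where
  private C = Carrier M

  Par : Set
  Par = Σ C A

  FormulaOver : ℕ → Set
  FormulaOver k = Formula L Par k

  SatA : ∀ {k} → (Fin k → C) → FormulaOver k → Set
  SatA s φ = Sat M proj₁ s φ

  SameType : ∀ {k} → (Fin k → C) → (Fin k → C) → Set
  SameType a b = ∀ (χ : FormulaOver _) → SatA a χ ⇔ SatA b χ

  -- ψ isolates tp(a/A): ψ ∈ tp(a/A) and ψ implies (in M, i.e. in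
  -- Th(M_A)) every formula of tp(a/A).
  Isolates : ∀ {k} → FormulaOver k → (Fin k → C) → Set
  Isolates ψ a = SatA a ψ ×
    (∀ (χ : FormulaOver _) → SatA a χ → ∀ (x : Fin _ → C) → SatA x ψ → SatA x χ)

  IsolatedType : ∀ {k} → (Fin k → C) → Set
  IsolatedType a = Σ (FormulaOver _) (λ ψ → Isolates ψ a)

  AtomicOver : Set
  AtomicOver = ∀ (k : ℕ) (a : Fin k → C) → IsolatedType a

  record Aut : Set where
    field
      to       : C → C
      from     : C → C
      to-from  : ∀ x → to (from x) ≡ x
      from-to  : ∀ x → from (to x) ≡ x
      pres-fun : ∀ f (v : Vec C (farity L f)) → to (funI M f v) ≡ funI M f (map to v)
      pres-rel : ∀ r (v : Vec C (rarity L r)) → relI M r v ⇔ relI M r (map to v)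
      fixes    : ∀ a → A a → to a ≡ a
  open Aut public

  idAut : Aut
  idAut = record
    { to = λ x → x ; from = λ x → x
    ; to-from = λ _ → refl ; from-to = λ _ → refl
    ; pres-fun = λ f v → cong (funI M f) (sym (map-id v))
    ; pres-rel = λ r v → subst (λ w → relI M r v ⇔ relI M r w) (sym (map-id v))
                           (mk⇔ (λ z → z) (λ z → z))
    ; fixes = λ _ _ → refl }

  _∘Aut_ : Aut → Aut → Aut
  σ ∘Aut τ = record
    { to = λ x → to σ (to τ x)
    ; from = λ x → from τ (from σ x)
    ; to-from = λ x → trans (cong (to σ) (to-from τ (from σ x))) (to-from σ x)
    ; from-to = λ x → trans (cong (from τ) (from-to σ (to τ x))) (from-to τ x)
    ; pres-fun = λ f v → trans (cong (to σ) (pres-fun τ f v))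
                          (trans (pres-fun σ f (map (to τ) v))
                                 (cong (funI M f) (sym (map-∘ (to σ) (to τ) v))))
    ; pres-rel = λ r v →
        let e1 = pres-rel τ r v
            e2 = pres-rel σ r (map (to τ) v)
            eq = sym (map-∘ (to σ) (to τ) v)
        in mk⇔ (λ z → subst (relI M r) eq (Equivalence.to e2 (Equivalence.to e1 z)))
               (λ z → Equivalence.from e1 (Equivalence.from e2 (subst (relI M r) (sym eq) z)))
    ; fixes = λ a Aa → trans (cong (to σ) (fixes τ a Aa)) (fixes σ a Aa) }

  _⁻¹Aut : Aut → Aut
  σ ⁻¹Aut = record
    { to = from σ ; from = to σ
    ; to-from = from-to σ ; from-to = to-from σ
    ; pres-fun = λ f v →
        trans (cong (from σ) (cong (funI M f) (sym (back v))))
              (trans (cong (from σ) (sym (pres-fun σ f (map (from σ) v))))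
                     (from-to σ _))
    ; pres-rel = λ r v →
        let e = pres-rel σ r (map (from σ) v)
        in mk⇔ (λ z → Equivalence.from e (subst (relI M r) (sym (back v)) z))
               (λ z → subst (relI M r) (back v) (Equivalence.to e z))
    ; fixes = λ a Aa → trans (cong (from σ) (sym (fixes σ a Aa))) (from-to σ a) }
    where
      back : ∀ {n} (v : Vec C n) → map (to σ) (map (from σ) v) ≡ v
      back v = trans (sym (map-∘ (to σ) (from σ) v))
                     (trans (map-cong (to-from σ) v) (map-id v))

  IsSubgroup : (Aut → Set) → Set
  IsSubgroup S = S idAut
               × (∀ σ τ → S σ → S τ → S (σ ∘Aut τ))
               × (∀ σ → S σ → S (σ ⁻¹Aut))

  StronglyωHomogeneousOver : Set
  StronglyωHomogeneousOver =
    ∀ (k : ℕ) (a b : Fin k → C) → SameType a b →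
      Σ Aut (λ σ → ∀ i → to σ (a i) ≡ b i)

record ElemEmbedding {L : Signature} (M N : Structure L) : Set where
  field
    emb  : Carrier M → Carrier N
    elem : ∀ {k} (φ : Formula L ⊥ k) (s : Fin k → Carrier M) →
             Sat M noParams s φ ⇔ Sat N noParams (λ i → emb (s i)) φ
open ElemEmbedding public

-- Parameters of type P interpreted in N by π; x̄ are the first n
-- variables of φ, ȳ the last n.
EquivOnRealizations : ∀ {L P} (N : Structure L) (π : P → Carrier N) {n : ℕ} →
  Formula L P (n + n) → Formula L P n → Set
EquivOnRealizations N π {n} φ ψ =
  let R : (Fin n → Carrier N) → (Fin n → Carrier N) → Set
      R x y = Sat N π (x VF.++ y) φ
      Ψ : (Fin n → Carrier N) → Set
      Ψ x = Sat N π x ψ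
  in (∀ x → Ψ x → R x x)
   × (∀ x y → Ψ x → Ψ y → R x y → R y x)
   × (∀ x y z → Ψ x → Ψ y → Ψ z → R x y → R y z → R x z)

-- By isolation and homogeneity every realization of ψ in M is σ(b̄) for some
-- σ ∈ Aut(M/A), and since automorphisms preserve satisfaction,
-- φ(σ(b̄), τ(b̄)) holds iff τ⁻¹σ lies in the subgroup H = {σ : φ(σ(b̄), b̄)}.
-- So on ψ(M) the relation φ is "lying in the same left coset of H", an
-- equivalence relation.  Reflexivity, symmetry and transitivity of φ on ψ are
-- expressed by three formulas over A, universally valid in M; replacing the
-- parameters from A by fresh variables turns them into formulas over the empty
-- set, so they remain universally valid in every elementary extension.
module Submission where

open import Defs
open import Data.Nat using (ℕ; zero; suc; _+_)
open import Data.Fin using (Fin; zero; suc; _↑ˡ_; _↑ʳ_; splitAt; lift)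
open import Data.Vec using (Vec; []; _∷_; map)
import Data.Vec.Functional as VF
open import Data.Vec.Functional using (_++_; head; tail)
open import Data.Vec.Functional.Properties using (lookup-++ˡ; lookup-++ʳ; ++-cong)
open import Data.Empty using (⊥)
open import Data.Product using (Σ; _×_; _,_; proj₁; proj₂)
open import Data.Product.Function.NonDependent.Propositional using (_×-⇔_)
open import Data.Sum.Properties using ([,]-∘; [,]-map)
open import Function using (_∘_; id; _$_)
open import Function.Bundles using (_⇔_; mk⇔; Equivalence)
open import Function.Construct.Identity using (⇔-id)
open import Function.Construct.Composition using (_⇔-∘_)
open import Function.Related.TypeIsomorphisms using (→-cong-⇔; ¬-cong-⇔)
open import Relation.Nullary.Negation using (Stable; negated-stable; ¬¬-map)
open import Relation.Binary.PropositionalEquality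

module ⇔ = Equivalence

Π-cong-⇔ : {A B : Set} {P : A → Set} {Q : B → Set} (f : A → B) (g : B → A) →
  (∀ y → f (g y) ≡ y) → (∀ x → P x ⇔ Q (f x)) → (∀ x → P x) ⇔ (∀ y → Q y)
Π-cong-⇔ {Q = Q} f g f∘g≗id P⇔Q = mk⇔
  (λ p y → subst Q (f∘g≗id y) (⇔.to (P⇔Q (g y)) (p (g y))))
  (λ q x → ⇔.from (P⇔Q x) (q (f x)))

≡⇒⇔ : {A B : Set} → A ≡ B → A ⇔ B
≡⇒⇔ refl = ⇔-id _

∘-++ : ∀ {A B : Set} {m n} (f : A → B) (x : Fin m → A) (y : Fin n → A) →
  f ∘ (x ++ y) ≗ (f ∘ x) ++ (f ∘ y)
∘-++ {m = m} f x y i = [,]-∘ f (splitAt m i)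

++-uncons : ∀ {A : Set} {m n} (x : Fin (suc m) → A) (s : Fin n → A) →
  x ++ s ≗ head x VF.∷ (tail x ++ s)
++-uncons x s zero = refl
++-uncons {m = m} x s (suc i) = [,]-map (splitAt m i)

∷-lift : ∀ {A : Set} {k j} {ρ : Fin k → Fin j} {t : Fin j → A} {s : Fin k → A} (c : A) →
  t ∘ ρ ≗ s → (c VF.∷ t) ∘ lift 1 ρ ≗ c VF.∷ s
∷-lift c h zero = refl
∷-lift c h (suc i) = h i

module _ {L : Signature} {K : Structure L} {A : Carrier K → Set} (g : Aut K A)
         {P : Set} {π : P → Carrier K} (g-fixes-π : ∀ p → to g (π p) ≡ π p) where

  private
    C = Carrier K

    to-injective : ∀ {x y} → to g x ≡ to g y → x ≡ y
    to-injective {x} {y} gx≡gy = begin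
      x               ≡⟨ from-to g x ⟨
      from g (to g x) ≡⟨ cong (from g) gx≡gy ⟩
      from g (to g y) ≡⟨ from-to g y ⟩
      y               ∎
      where open ≡-Reasoning

    ∷-aut : ∀ {k} {s s' : Fin k → C} (c : C) → to g ∘ s ≗ s' →
      to g ∘ (c VF.∷ s) ≗ to g c VF.∷ s'
    ∷-aut c h zero = refl
    ∷-aut c h (suc i) = h i

  mutual
    eval-aut : ∀ {k} {s s' : Fin k → C} → to g ∘ s ≗ s' →
      (t : Term L P k) → eval K π s' t ≡ to g (eval K π s t)
    eval-aut h (var i) = sym (h i)
    eval-aut h (par p) = sym (g-fixes-π p)
    eval-aut h (app f ts) = trans (cong (funI K f) (evals-aut h ts)) (sym (pres-fun g f _))

    evals-aut : ∀ {k n} {s s' : Fin k → C} → to g ∘ s ≗ s' →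
      (ts : Vec (Term L P k) n) → evals K π s' ts ≡ map (to g) (evals K π s ts)
    evals-aut h [] = refl
    evals-aut h (t ∷ ts) = cong₂ _∷_ (eval-aut h t) (evals-aut h ts)

  Sat-aut : ∀ {k} {s s' : Fin k → C} → to g ∘ s ≗ s' →
    (φ : Formula L P k) → Sat K π s φ ⇔ Sat K π s' φ
  Sat-aut h ⊥' = ⇔-id _
  Sat-aut h (t ≐ u) = ¬-cong-⇔ (¬-cong-⇔
    (≡⇒⇔ (sym (cong₂ _≡_ (eval-aut h t) (eval-aut h u))) ⇔-∘ mk⇔ (cong (to g)) to-injective))
  Sat-aut h (rel r ts) = ¬-cong-⇔ (¬-cong-⇔
    (≡⇒⇔ (sym (cong (relI K r) (evals-aut h ts))) ⇔-∘ pres-rel g r _))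
  Sat-aut h (¬' φ) = ¬-cong-⇔ (Sat-aut h φ)
  Sat-aut h (φ ∧' ψ) = Sat-aut h φ ×-⇔ Sat-aut h ψ
  Sat-aut h (φ ∨' ψ) = ¬-cong-⇔ (¬-cong-⇔ (Sat-aut h φ) ×-⇔ ¬-cong-⇔ (Sat-aut h ψ))
  Sat-aut h (φ ⇒' ψ) = →-cong-⇔ (Sat-aut h φ) (Sat-aut h ψ)
  Sat-aut h (∀' φ) = Π-cong-⇔ (to g) (from g) (to-from g) λ c → Sat-aut (∷-aut c h) φ
  Sat-aut h (∃' φ) =
    ¬-cong-⇔ (Π-cong-⇔ (to g) (from g) (to-from g) λ c → ¬-cong-⇔ (Sat-aut (∷-aut c h) φ))

module _ {L : Signature} {K : Structure L} {P : Set} {π : P → Carrier K} where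

  Sat-cong : ∀ {k} {s s' : Fin k → Carrier K} → s ≗ s' →
    (φ : Formula L P k) → Sat K π s φ ⇔ Sat K π s' φ
  Sat-cong = Sat-aut (idAut K (λ _ → ⊥)) (λ _ → refl)

  Sat-stable : ∀ {k} {s : Fin k → Carrier K} (φ : Formula L P k) → Stable (Sat K π s φ)
  Sat-stable ⊥' ¬¬⊥ = ¬¬⊥ id
  Sat-stable (t ≐ u) = negated-stable
  Sat-stable (rel r ts) = negated-stable
  Sat-stable (¬' φ) = negated-stable
  Sat-stable (φ ∧' ψ) h = Sat-stable φ (¬¬-map proj₁ h) , Sat-stable ψ (¬¬-map proj₂ h)
  Sat-stable (φ ∨' ψ) = negated-stable
  Sat-stable (φ ⇒' ψ) h a = Sat-stable ψ (¬¬-map (_$ a) h)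
  Sat-stable (∀' φ) h c = Sat-stable φ (¬¬-map (_$ c) h)
  Sat-stable (∃' φ) = negated-stable

∀ⁿ : ∀ {L P} n {k} → Formula L P (n + k) → Formula L P k
∀ⁿ zero φ = φ
∀ⁿ (suc n) φ = ∀ⁿ n (∀' φ)

module _ {L : Signature} {K : Structure L} {P : Set} {π : P → Carrier K} where

  Sat-∀ⁿ : ∀ n {k} (φ : Formula L P (n + k)) (s : Fin k → Carrier K) →
    Sat K π s (∀ⁿ n φ) ⇔ (∀ x → Sat K π (x ++ s) φ)
  Sat-∀ⁿ zero φ s = mk⇔ (λ h _ → h) (λ h → h λ ())
  Sat-∀ⁿ (suc n) φ s = mk⇔
    (λ h x → ⇔.from (Sat-cong (++-uncons x s) φ) (⇔.to (Sat-∀ⁿ n (∀' φ) s) h (tail x) (head x)))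
    (λ h → ⇔.from (Sat-∀ⁿ n (∀' φ) s) λ x c → ⇔.to (Sat-cong (++-uncons (c VF.∷ x) s) φ) (h _))

mutual
  renameᵗ : ∀ {L P k j} → (Fin k → Fin j) → Term L P k → Term L P j
  renameᵗ ρ (var i) = var (ρ i)
  renameᵗ ρ (par p) = par p
  renameᵗ ρ (app f ts) = app f (renameᵗˢ ρ ts)

  renameᵗˢ : ∀ {L P k j n} → (Fin k → Fin j) → Vec (Term L P k) n → Vec (Term L P j) n
  renameᵗˢ ρ [] = []
  renameᵗˢ ρ (t ∷ ts) = renameᵗ ρ t ∷ renameᵗˢ ρ ts

rename : ∀ {L P k j} → (Fin k → Fin j) → Formula L P k → Formula L P j
rename ρ ⊥' = ⊥'
rename ρ (t ≐ u) = renameᵗ ρ t ≐ renameᵗ ρ u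
rename ρ (rel r ts) = rel r (renameᵗˢ ρ ts)
rename ρ (¬' φ) = ¬' rename ρ φ
rename ρ (φ ∧' ψ) = rename ρ φ ∧' rename ρ ψ
rename ρ (φ ∨' ψ) = rename ρ φ ∨' rename ρ ψ
rename ρ (φ ⇒' ψ) = rename ρ φ ⇒' rename ρ ψ
rename ρ (∀' φ) = ∀' rename (lift 1 ρ) φ
rename ρ (∃' φ) = ∃' rename (lift 1 ρ) φ

module _ {L : Signature} {K : Structure L} {P : Set} {π : P → Carrier K} where

  private
    C = Carrier K

  mutual
    eval-rename : ∀ {k j} {ρ : Fin k → Fin j} {t : Fin j → C} {s : Fin k → C} → t ∘ ρ ≗ s →
      (u : Term L P k) → eval K π t (renameᵗ ρ u) ≡ eval K π s u
    eval-rename h (var i) = h i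
    eval-rename h (par p) = refl
    eval-rename h (app f us) = cong (funI K f) (evals-rename h us)

    evals-rename : ∀ {k j n} {ρ : Fin k → Fin j} {t : Fin j → C} {s : Fin k → C} → t ∘ ρ ≗ s →
      (us : Vec (Term L P k) n) → evals K π t (renameᵗˢ ρ us) ≡ evals K π s us
    evals-rename h [] = refl
    evals-rename h (u ∷ us) = cong₂ _∷_ (eval-rename h u) (evals-rename h us)

  Sat-rename : ∀ {k j} {ρ : Fin k → Fin j} {t : Fin j → C} {s : Fin k → C} → t ∘ ρ ≗ s →
    (φ : Formula L P k) → Sat K π t (rename ρ φ) ⇔ Sat K π s φ
  Sat-rename h ⊥' = ⇔-id _
  Sat-rename h (u ≐ u′) =
    ¬-cong-⇔ (¬-cong-⇔ (≡⇒⇔ (cong₂ _≡_ (eval-rename h u) (eval-rename h u′))))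
  Sat-rename h (rel r us) = ¬-cong-⇔ (¬-cong-⇔ (≡⇒⇔ (cong (relI K r) (evals-rename h us))))
  Sat-rename h (¬' φ) = ¬-cong-⇔ (Sat-rename h φ)
  Sat-rename h (φ ∧' ψ) = Sat-rename h φ ×-⇔ Sat-rename h ψ
  Sat-rename h (φ ∨' ψ) = ¬-cong-⇔ (¬-cong-⇔ (Sat-rename h φ) ×-⇔ ¬-cong-⇔ (Sat-rename h ψ))
  Sat-rename h (φ ⇒' ψ) = →-cong-⇔ (Sat-rename h φ) (Sat-rename h ψ)
  Sat-rename h (∀' φ) = Π-cong-⇔ id id (λ _ → refl) λ c → Sat-rename (∷-lift c h) φ
  Sat-rename h (∃' φ) =
    ¬-cong-⇔ (Π-cong-⇔ id id (λ _ → refl) λ c → ¬-cong-⇔ (Sat-rename (∷-lift c h) φ))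

-- Replacing parameters by variables

-- Every occurrence of a parameter gets its own variable; `body v w` places the
-- free variables at v and the parameter occurrences at w.
record Abstraction (P : Set) (F : ℕ → Set) (k : ℕ) : Set where
  field
    size   : ℕ
    params : Fin size → P
    body   : ∀ {j} → (Fin k → Fin j) → (Fin size → Fin j) → F j
open Abstraction

module _ {P : Set} {k : ℕ} {F : ℕ → Set} where

  leaf : (∀ {j} → (Fin k → Fin j) → F j) → Abstraction P F k
  leaf f = record { size = 0 ; params = λ () ; body = λ v _ → f v }

  mapᴬ : ∀ {G} → (∀ {j} → F j → G j) → Abstraction P F k → Abstraction P G k
  mapᴬ op a = record { size = size a ; params = params a ; body = λ v w → op (body a v w) }

  combine : ∀ {G H} → (∀ {j} → F j → G j → H j) →
    Abstraction P F k → Abstraction P G k → Abstraction P H k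
  combine op a b = record
    { size   = size a + size b
    ; params = params a ++ params b
    ; body   = λ v w → op (body a v (w ∘ (_↑ˡ size b))) (body b v (w ∘ (size a ↑ʳ_)))
    }

  binder : ∀ {G} → (∀ {j} → F (suc j) → G j) → Abstraction P F (suc k) → Abstraction P G k
  binder op a = record
    { size = size a ; params = params a ; body = λ v w → op (body a (lift 1 v) (suc ∘ w)) }

module _ {L : Signature} {P : Set} where

  mutual
    abstractᵗ : ∀ {k} → Term L P k → Abstraction P (Term L ⊥) k
    abstractᵗ (var i) = leaf λ v → var (v i)
    abstractᵗ (par p) = record { size = 1 ; params = λ _ → p ; body = λ _ w → var (w zero) }
    abstractᵗ (app f ts) = mapᴬ (app f) (abstractᵗˢ ts)

    abstractᵗˢ : ∀ {k n} → Vec (Term L P k) n → Abstraction P (λ j → Vec (Term L ⊥ j) n) k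
    abstractᵗˢ [] = leaf λ _ → []
    abstractᵗˢ (t ∷ ts) = combine _∷_ (abstractᵗ t) (abstractᵗˢ ts)

  abstractᶠ : ∀ {k} → Formula L P k → Abstraction P (Formula L ⊥) k
  abstractᶠ ⊥' = leaf λ _ → ⊥'
  abstractᶠ (t ≐ u) = combine _≐_ (abstractᵗ t) (abstractᵗ u)
  abstractᶠ (rel r ts) = mapᴬ (rel r) (abstractᵗˢ ts)
  abstractᶠ (¬' φ) = mapᴬ ¬'_ (abstractᶠ φ)
  abstractᶠ (φ ∧' ψ) = combine _∧'_ (abstractᶠ φ) (abstractᶠ ψ)
  abstractᶠ (φ ∨' ψ) = combine _∨'_ (abstractᶠ φ) (abstractᶠ ψ)
  abstractᶠ (φ ⇒' ψ) = combine _⇒'_ (abstractᶠ φ) (abstractᶠ ψ)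
  abstractᶠ (∀' φ) = binder ∀'_ (abstractᶠ φ)
  abstractᶠ (∃' φ) = binder ∃'_ (abstractᶠ φ)

module _ {L : Signature} {K : Structure L} {P : Set} {π : P → Carrier K} where

  private
    C = Carrier K

    module _ {m n j} (t : Fin j → C) (w : Fin (m + n) → Fin j) {p : Fin m → P} {q : Fin n → P}
             (t∘w≗π∘p++q : t ∘ w ≗ π ∘ (p ++ q)) where
      ≗-++ˡ : t ∘ (w ∘ (_↑ˡ n)) ≗ π ∘ p
      ≗-++ˡ i = trans (t∘w≗π∘p++q (i ↑ˡ n)) (cong π (lookup-++ˡ p q i))

      ≗-++ʳ : t ∘ (w ∘ (m ↑ʳ_)) ≗ π ∘ q
      ≗-++ʳ i = trans (t∘w≗π∘p++q (m ↑ʳ i)) (cong π (lookup-++ʳ p q i))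

  mutual
    eval-abstract : ∀ {k j} {v : Fin k → Fin j} {t : Fin j → C} {s : Fin k → C}
      (u : Term L P k) {w : Fin (size (abstractᵗ u)) → Fin j} →
      t ∘ v ≗ s → t ∘ w ≗ π ∘ params (abstractᵗ u) →
      eval K noParams t (body (abstractᵗ u) v w) ≡ eval K π s u
    eval-abstract (var i) hv hw = hv i
    eval-abstract (par p) hv hw = hw zero
    eval-abstract (app f us) hv hw = cong (funI K f) (evals-abstract us hv hw)

    evals-abstract : ∀ {k j n} {v : Fin k → Fin j} {t : Fin j → C} {s : Fin k → C}
      (us : Vec (Term L P k) n) {w : Fin (size (abstractᵗˢ us)) → Fin j} →
      t ∘ v ≗ s → t ∘ w ≗ π ∘ params (abstractᵗˢ us) →
      evals K noParams t (body (abstractᵗˢ us) v w) ≡ evals K π s us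
    evals-abstract [] hv hw = refl
    evals-abstract {t = t} (u ∷ us) {w} hv hw =
      cong₂ _∷_ (eval-abstract u hv (≗-++ˡ t w hw)) (evals-abstract us hv (≗-++ʳ t w hw))

  Sat-abstract : ∀ {k j} {v : Fin k → Fin j} {t : Fin j → C} {s : Fin k → C}
    (φ : Formula L P k) {w : Fin (size (abstractᶠ φ)) → Fin j} →
    t ∘ v ≗ s → t ∘ w ≗ π ∘ params (abstractᶠ φ) →
    Sat K noParams t (body (abstractᶠ φ) v w) ⇔ Sat K π s φ
  Sat-abstract ⊥' hv hw = ⇔-id _
  Sat-abstract {t = t} (u ≐ u′) {w} hv hw = ¬-cong-⇔ (¬-cong-⇔
    (≡⇒⇔ (cong₂ _≡_ (eval-abstract u hv (≗-++ˡ t w hw)) (eval-abstract u′ hv (≗-++ʳ t w hw)))))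
  Sat-abstract (rel r us) hv hw =
    ¬-cong-⇔ (¬-cong-⇔ (≡⇒⇔ (cong (relI K r) (evals-abstract us hv hw))))
  Sat-abstract (¬' φ) hv hw = ¬-cong-⇔ (Sat-abstract φ hv hw)
  Sat-abstract {t = t} (φ ∧' ψ) {w} hv hw =
    Sat-abstract φ hv (≗-++ˡ t w hw) ×-⇔ Sat-abstract ψ hv (≗-++ʳ t w hw)
  Sat-abstract {t = t} (φ ∨' ψ) {w} hv hw =
    ¬-cong-⇔ (¬-cong-⇔ (Sat-abstract φ hv (≗-++ˡ t w hw))
          ×-⇔ ¬-cong-⇔ (Sat-abstract ψ hv (≗-++ʳ t w hw)))
  Sat-abstract {t = t} (φ ⇒' ψ) {w} hv hw =
    →-cong-⇔ (Sat-abstract φ hv (≗-++ˡ t w hw)) (Sat-abstract ψ hv (≗-++ʳ t w hw))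
  Sat-abstract (∀' φ) {w} hv hw =
    Π-cong-⇔ id id (λ _ → refl) λ c → Sat-abstract φ {suc ∘ w} (∷-lift c hv) hw
  Sat-abstract (∃' φ) {w} hv hw =
    ¬-cong-⇔ (Π-cong-⇔ id id (λ _ → refl) λ c →
      ¬-cong-⇔ (Sat-abstract φ {suc ∘ w} (∷-lift c hv) hw))

Valid : ∀ {L P k} (K : Structure L) → (P → Carrier K) → Formula L P k → Set
Valid K π φ = ∀ s → Sat K π s φ

Valid-elem : ∀ {L} {M N : Structure L} (e : ElemEmbedding M N) {P k} {π : P → Carrier M}
  (θ : Formula L P k) → Valid M π θ → Valid N (emb e ∘ π) θ
Valid-elem {M = M} {N} e {k = k} {π} θ valid x =
  ⇔.to (Sat-abstract θ (lookup-++ˡ x _) (lookup-++ʳ x _)) (⇔.to (Sat-∀ⁿ k θ₀ _) closedN x)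
  where
    a = abstractᶠ θ
    θ₀ : Formula _ ⊥ (k + size a)
    θ₀ = body a (_↑ˡ size a) (k ↑ʳ_)

    closedM : Sat M noParams (π ∘ params a) (∀ⁿ k θ₀)
    closedM = ⇔.from (Sat-∀ⁿ k θ₀ _) λ y →
      ⇔.from (Sat-abstract θ (lookup-++ˡ y _) (lookup-++ʳ y _)) (valid y)

    closedN : Sat N noParams (emb e ∘ π ∘ params a) (∀ⁿ k θ₀)
    closedN = ⇔.to (elem e (∀ⁿ k θ₀) _) closedM

module EquivalenceAxioms {L : Signature} {P : Set} {n : ℕ}
                         (φ : Formula L P (n + n)) (ψ : Formula L P n) where

  Ctx : ℕ
  Ctx = n + (n + n)

  X Y Z : Fin n → Fin Ctx
  X i = i ↑ˡ (n + n)
  Y i = n ↑ʳ (i ↑ˡ n)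
  Z i = n ↑ʳ (n ↑ʳ i)

  ψ⟨_⟩ : (Fin n → Fin Ctx) → Formula L P Ctx
  ψ⟨ V ⟩ = rename V ψ

  φ⟨_,_⟩ : (Fin n → Fin Ctx) → (Fin n → Fin Ctx) → Formula L P Ctx
  φ⟨ V , W ⟩ = rename (V ++ W) φ

  reflexivity symmetry transitivity : Formula L P Ctx
  reflexivity  = ψ⟨ X ⟩ ⇒' φ⟨ X , X ⟩
  symmetry     = ψ⟨ X ⟩ ⇒' (ψ⟨ Y ⟩ ⇒' (φ⟨ X , Y ⟩ ⇒' φ⟨ Y , X ⟩))
  transitivity = ψ⟨ X ⟩ ⇒' (ψ⟨ Y ⟩ ⇒' (ψ⟨ Z ⟩ ⇒' (φ⟨ X , Y ⟩ ⇒' (φ⟨ Y , Z ⟩ ⇒' φ⟨ X , Z ⟩))))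

  module _ (K : Structure L) (π : P → Carrier K) where

    private
      C = Carrier K

      Ψ : (Fin n → C) → Set
      Ψ x = Sat K π x ψ

      R : (Fin n → C) → (Fin n → C) → Set
      R x y = Sat K π (x ++ y) φ

      ≗-refl : (f : Fin n → C) → f ≗ f
      ≗-refl f _ = refl

      Sat-ψ⟨⟩ : ∀ {t : Fin Ctx → C} {V x} → t ∘ V ≗ x → Sat K π t ψ⟨ V ⟩ ⇔ Ψ x
      Sat-ψ⟨⟩ h = Sat-rename h ψ

      Sat-φ⟨⟩ : ∀ {t : Fin Ctx → C} {V W x y} → t ∘ V ≗ x → t ∘ W ≗ y →
        Sat K π t φ⟨ V , W ⟩ ⇔ R x y
      Sat-φ⟨⟩ {t} {V} {W} hV hW = Sat-rename (λ i → trans (∘-++ t V W i) (++-cong _ _ hV hW i)) φ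

      module _ (x y z : Fin n → C) where
        t : Fin Ctx → C
        t = x ++ (y ++ z)

        tX : t ∘ X ≗ x
        tX = lookup-++ˡ x _

        tY : t ∘ Y ≗ y
        tY i = trans (lookup-++ʳ x _ _) (lookup-++ˡ y z i)

        tZ : t ∘ Z ≗ z
        tZ i = trans (lookup-++ʳ x _ _) (lookup-++ʳ y z i)

    Reflexive Symmetric Transitive : Set
    Reflexive = ∀ x → Ψ x → R x x
    Symmetric = ∀ x y → Ψ x → Ψ y → R x y → R y x
    Transitive = ∀ x y z → Ψ x → Ψ y → Ψ z → R x y → R y z → R x z

    Reflexive⇔Valid : Reflexive ⇔ Valid K π reflexivity
    Reflexive⇔Valid = mk⇔
      (λ refl′ s ψX → let sX = ≗-refl (s ∘ X) in
        ⇔.from (Sat-φ⟨⟩ sX sX) (refl′ _ (⇔.to (Sat-ψ⟨⟩ sX) ψX)))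
      (λ valid x ψx → let tx = tX x x x in
        ⇔.to (Sat-φ⟨⟩ tx tx) (valid (t x x x) (⇔.from (Sat-ψ⟨⟩ tx) ψx)))

    Symmetric⇔Valid : Symmetric ⇔ Valid K π symmetry
    Symmetric⇔Valid = mk⇔
      (λ sym′ s ψX ψY φXY → let sX = ≗-refl (s ∘ X) ; sY = ≗-refl (s ∘ Y) in
        ⇔.from (Sat-φ⟨⟩ sY sX)
          (sym′ _ _ (⇔.to (Sat-ψ⟨⟩ sX) ψX) (⇔.to (Sat-ψ⟨⟩ sY) ψY) (⇔.to (Sat-φ⟨⟩ sX sY) φXY)))
      (λ valid x y ψx ψy φxy → let tx = tX x y x ; ty = tY x y x in
        ⇔.to (Sat-φ⟨⟩ ty tx)
          (valid (t x y x) (⇔.from (Sat-ψ⟨⟩ tx) ψx) (⇔.from (Sat-ψ⟨⟩ ty) ψy)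
                           (⇔.from (Sat-φ⟨⟩ tx ty) φxy)))

    Transitive⇔Valid : Transitive ⇔ Valid K π transitivity
    Transitive⇔Valid = mk⇔
      (λ trans′ s ψX ψY ψZ φXY φYZ →
        let sX = ≗-refl (s ∘ X) ; sY = ≗-refl (s ∘ Y) ; sZ = ≗-refl (s ∘ Z) in
        ⇔.from (Sat-φ⟨⟩ sX sZ)
          (trans′ _ _ _ (⇔.to (Sat-ψ⟨⟩ sX) ψX) (⇔.to (Sat-ψ⟨⟩ sY) ψY) (⇔.to (Sat-ψ⟨⟩ sZ) ψZ)
                        (⇔.to (Sat-φ⟨⟩ sX sY) φXY) (⇔.to (Sat-φ⟨⟩ sY sZ) φYZ)))
      (λ valid x y z ψx ψy ψz φxy φyz → let tx = tX x y z ; ty = tY x y z ; tz = tZ x y z in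
        ⇔.to (Sat-φ⟨⟩ tx tz)
          (valid (t x y z) (⇔.from (Sat-ψ⟨⟩ tx) ψx) (⇔.from (Sat-ψ⟨⟩ ty) ψy)
                           (⇔.from (Sat-ψ⟨⟩ tz) ψz)
                           (⇔.from (Sat-φ⟨⟩ tx ty) φxy) (⇔.from (Sat-φ⟨⟩ ty tz) φyz)))

    EquivOnRealizations⇔Valid : EquivOnRealizations K π φ ψ ⇔
      (Valid K π reflexivity × Valid K π symmetry × Valid K π transitivity)
    EquivOnRealizations⇔Valid = Reflexive⇔Valid ×-⇔ Symmetric⇔Valid ×-⇔ Transitive⇔Valid

module _ {L : Signature} {M : Structure L} {A : Carrier M → Set} where

  Isolates⇒SameType : ∀ {k} {ψ : FormulaOver M A k} {b x : Fin k → Carrier M} →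
    Isolates M A ψ b → SatA M A x ψ → SameType M A b x
  Isolates⇒SameType (_ , ψ⊢) x⊨ψ χ = mk⇔
    (λ b⊨χ → ψ⊢ χ b⊨χ _ x⊨ψ)
    (λ x⊨χ → Sat-stable χ λ b⊭χ → ψ⊢ (¬' χ) b⊭χ _ x⊨ψ x⊨χ)

  Isolates⇒conjugate : StronglyωHomogeneousOver M A →
    ∀ {k} {ψ : FormulaOver M A k} {b x : Fin k → Carrier M} →
    Isolates M A ψ b → SatA M A x ψ → Σ (Aut M A) λ σ → to σ ∘ b ≗ x
  Isolates⇒conjugate homogeneous {k} {b = b} {x} ψ-isolates x⊨ψ =
    homogeneous k b x (Isolates⇒SameType ψ-isolates x⊨ψ)

module Cosets {L : Signature} {M : Structure L} {A : Carrier M → Set} {n : ℕ}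
              (φ : FormulaOver M A (n + n)) (b : Fin n → Carrier M) where

  private
    _∙_ : Aut M A → Aut M A → Aut M A
    _∙_ = _∘Aut_ M A

    _⁻¹ : Aut M A → Aut M A
    _⁻¹ = _⁻¹Aut M A

  H : Aut M A → Set
  H σ = SatA M A ((to σ ∘ b) ++ b) φ

  H-resp : ∀ σ τ → to σ ∘ b ≗ to τ ∘ b → H σ → H τ
  H-resp _ _ σb≗τb = ⇔.to (Sat-cong (++-cong _ _ σb≗τb (λ _ → refl)) φ)

  related⇔sameCoset : ∀ σ τ {x y} → to σ ∘ b ≗ x → to τ ∘ b ≗ y →
    SatA M A (x ++ y) φ ⇔ H ((τ ⁻¹) ∙ σ)
  related⇔sameCoset σ τ σb≗x τb≗y =
    Sat-aut (τ ⁻¹) (λ p → fixes (τ ⁻¹) (proj₁ p) (proj₂ p)) τ⁻¹[x++y]≗τ⁻¹σb++b φ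
    ⇔-∘ Sat-cong (++-cong _ _ (sym ∘ σb≗x) (sym ∘ τb≗y)) φ
    where
      τ⁻¹[x++y]≗τ⁻¹σb++b : from τ ∘ ((to σ ∘ b) ++ (to τ ∘ b)) ≗ (from τ ∘ to σ ∘ b) ++ b
      τ⁻¹[x++y]≗τ⁻¹σb++b i =
        trans (∘-++ (from τ) (to σ ∘ b) (to τ ∘ b) i) (++-cong _ _ (λ _ → refl) (from-to τ ∘ b) i)

  subgroup⇒EquivOnRealizations : StronglyωHomogeneousOver M A → IsSubgroup M A H →
    ∀ {ψ} → Isolates M A ψ b → EquivOnRealizations M proj₁ φ ψ
  subgroup⇒EquivOnRealizations homogeneous (H-id , H-∙ , H-⁻¹) {ψ} ψ-isolates =
    reflexive , symmetric , transitive
    where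
      open EquivalenceAxioms φ ψ using (Reflexive; Symmetric; Transitive)

      conjugate : ∀ {x} → SatA M A x _ → Σ (Aut M A) λ σ → to σ ∘ b ≗ x
      conjugate = Isolates⇒conjugate homogeneous ψ-isolates

      reflexive : Reflexive M proj₁
      reflexive x x⊨ψ with conjugate x⊨ψ
      ... | σ , σb≗x =
        ⇔.from (related⇔sameCoset σ σ σb≗x σb≗x)
          (H-resp (idAut M A) ((σ ⁻¹) ∙ σ) (λ i → sym (from-to σ (b i))) H-id)

      symmetric : Symmetric M proj₁
      symmetric x y x⊨ψ y⊨ψ xRy with conjugate x⊨ψ | conjugate y⊨ψ
      ... | σ , σb≗x | τ , τb≗y =
        ⇔.from (related⇔sameCoset τ σ τb≗y σb≗x)
          (H-⁻¹ ((τ ⁻¹) ∙ σ) (⇔.to (related⇔sameCoset σ τ σb≗x τb≗y) xRy))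

      transitive : Transitive M proj₁
      transitive x y z x⊨ψ y⊨ψ z⊨ψ xRy yRz with conjugate x⊨ψ | conjugate y⊨ψ | conjugate z⊨ψ
      ... | σ , σb≗x | τ , τb≗y | ρ , ρb≗z =
        ⇔.from (related⇔sameCoset σ ρ σb≗x ρb≗z)
          (H-resp (((ρ ⁻¹) ∙ τ) ∙ ((τ ⁻¹) ∙ σ)) ((ρ ⁻¹) ∙ σ)
            (λ i → cong (from ρ) (to-from τ (to σ (b i))))
            (H-∙ ((ρ ⁻¹) ∙ τ) ((τ ⁻¹) ∙ σ)
              (⇔.to (related⇔sameCoset τ ρ τb≗y ρb≗z) yRz)
              (⇔.to (related⇔sameCoset σ τ σb≗x τb≗y) xRy)))

lemma3p1 : (L : Signature) (T : Theory L) → Complete T →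
    (M : Structure L) → IsModel T M →
    (A : Carrier M → Set) →
    AtomicOver M A → StronglyωHomogeneousOver M A →
    (n : ℕ) (φ : FormulaOver M A (n + n)) (b : Fin n → Carrier M) →
    IsSubgroup M A (λ σ → SatA M A ((λ i → to σ (b i)) ++ b) φ) →
    (ψ : FormulaOver M A n) → Isolates M A ψ b →
    EquivOnRealizations M proj₁ φ ψ
    × (∀ (N : Structure L) (e : ElemEmbedding M N) →
         EquivOnRealizations N (λ p → emb e (proj₁ p)) φ ψ)
lemma3p1 _ _ _ M _ A _ homogeneous n φ b H-subgroup ψ ψ-isolates = inM , inN
  where
    open EquivalenceAxioms φ ψ

    inM : EquivOnRealizations M proj₁ φ ψ
    inM = Cosets.subgroup⇒EquivOnRealizations φ b homogeneous H-subgroup ψ-isolates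

    inN : ∀ N (e : ElemEmbedding M N) → EquivOnRealizations N (λ p → emb e (proj₁ p)) φ ψ
    inN N e with ⇔.to (EquivOnRealizations⇔Valid M proj₁) inM
    ... | r , s , t = ⇔.from (EquivOnRealizations⇔Valid N _)
      (Valid-elem e reflexivity r , Valid-elem e symmetry s , Valid-elem e transitivity t)
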